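{- Let $S\subset\mathbb{R}$ with $|S|=k$, let $\mathcal{A}$ be a surrounding-oriented MPFS algorithm for $\mathrm{OFAL}(S,1)$, let $\sigma=r_1\cdots r_k$, $1\le i\le k$, and $s\in F_{i-1}(\mathcal{A})$ with $s\ne s_{\mathcal{A}}(r_i;\sigma)$, such that no server of $F_{i-1}(\mathcal{A})$ lies strictly between $s_{\mathcal{A}}(r_i;\sigma)$ and $s$. Let $t^*$, $a_t$, $h_t$ ($i\le t\le t^*$) be as in the context. Then for each $i\le t\le t^*$ there is no server of $F_t(\mathcal{A})\cap F_t(\mathcal{H}_{i,s})$ strictly between $a_t$ and $h_t$, and either (M1) $a_{t^*}\le\cdots\le a_i<h_i\le\cdots\le h_{t^*}$, or (M2) $h_{t^*}\le\cdots\le h_i<a_i\le\cdots\le a_{t^*}$.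
   Context: $\mathrm{OFAL}(S,1)$: servers $S$ at distinct points of $\mathbb{R}$ (identified with positions), each of capacity 1; requests $r_1,r_2,\ldots$ (points of $\mathbb{R}$, at most $|S|$ of them) arrive one at a time and each must be irrevocably matched upon arrival with a free (not yet matched) server $s$ at cost $|r-s|$. $s_{\mathcal{A}}(r_i;\sigma)$ is the server with which $\mathcal{A}$ matches $r_i$; $F_i(\mathcal{A})$ is the set of free servers just after $\mathcal{A}$ matches $r_i$ ($F_0=S$). MPFS algorithm: for each request a priority order on all servers is determined solely by the request's position, and the request is matched with the free server of highest priority. Surrounding servers of a request $r$: the closest free server to the left of $r$ (if any) and the closest free server to the right of $r$ (if any); if $r$ coincides with a free server $s$, then $s$ is the only surrounding server. An algorithm is surrounding-oriented if it always matches each request with one of its surrounding servers. Hybrid algorithm $\mathcal{H}_{i,s}$ (for $s\in F_{i-1}(\mathcal{A})$): matches $r_1,\ldots,r_{i-1}$ as $\mathcal{A}$, $r_i$ with $s$, and each later request with its highest-priority server (under $\mathcal{A}$'s priority rule) among its own current free servers. Then there is $t^*\ge i$ such that $F_t(\mathcal{A})\ne F_t(\mathcal{H}_{i,s})$ for $i\le t\le t^*$ and $F_t(\mathcal{A})=F_t(\mathcal{H}_{i,s})$ for $t>t^*$; for $i\le t\le t^*$, $a_t,h_t$ denote the servers with $F_t(\mathcal{A})\setminus F_t(\mathcal{H}_{i,s})=\{a_t\}$ and $F_t(\mathcal{H}_{i,s})\setminus F_t(\mathcal{A})=\{h_t\}$. -}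

module Defs where

open import Data.Nat using (ℕ; zero; suc; _≟_)
open import Data.Bool using (Bool; true; false; if_then_else_)
open import Data.Fin using (Fin)
open import Data.Fin.Subset using (Subset; ⊤; _∈_; _∉_; outside)
open import Data.List using (List; []; _∷_)
open import Data.Vec using (Vec; []; _∷_; lookup; _[_]≔_)
open import Data.Maybe using (Maybe; just; nothing)
open import Data.Product using (_×_; Σ; _,_)
open import Data.Sum using (_⊎_)
open import Relation.Nullary using (¬_; yes; no)
open import Relation.Binary.PropositionalEquality using (_≡_)

-- Positions: an arbitrary type `Pos` with a strict total order `_<_`
-- (w.r.t. propositional equality); ℝ is the intended instance.
-- Servers: `Fin k`, located at pairwise distinct positions `pos : Fin k → Pos`.
-- An MPFS priority rule: `prio : Pos → List (Fin k)`, listing all servers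
-- from highest to lowest priority for a request at the given position.

lookupℕ : {A : Set} {n : ℕ} → Vec A n → ℕ → Maybe A
lookupℕ []       _       = nothing
lookupℕ (x ∷ xs) zero    = just x
lookupℕ (x ∷ xs) (suc t) = lookupℕ xs t

first : {k : ℕ} → List (Fin k) → Subset k → Maybe (Fin k)
first []       F = nothing
first (x ∷ xs) F = if lookup F x then just x else first xs F

removeM : {k : ℕ} → Subset k → Maybe (Fin k) → Subset k
removeM F nothing  = F
removeM F (just s) = F [ s ]≔ outside

mpfsStep : {Pos : Set} {k : ℕ} → (Pos → List (Fin k)) → Subset k → Maybe Pos → Subset k
mpfsStep prio F nothing  = F
mpfsStep prio F (just r) = removeM F (first (prio r) F)

-- Free sets of a run.  `dev = nothing` : the MPFS algorithm A itself.
-- `dev = just (i , s)` : the hybrid H_{i,s}, which matches r_i with s and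
-- otherwise follows A's priority rule on its own free servers.
-- `run prio σ dev t` is F_t (free servers just after the t-th request; F_0 = S).
run : {Pos : Set} {k : ℕ} → (Pos → List (Fin k)) → Vec Pos k → Maybe (ℕ × Fin k) → ℕ → Subset k
run prio σ dev zero = ⊤
run prio σ nothing (suc t) = mpfsStep prio (run prio σ nothing t) (lookupℕ σ t)
run prio σ (just (i , s)) (suc t) with suc t ≟ i
... | yes _ = run prio σ (just (i , s)) t [ s ]≔ outside
... | no  _ = mpfsStep prio (run prio σ (just (i , s)) t) (lookupℕ σ t)

FA : {Pos : Set} {k : ℕ} → (Pos → List (Fin k)) → Vec Pos k → ℕ → Subset k
FA prio σ = run prio σ nothing

FH : {Pos : Set} {k : ℕ} → (Pos → List (Fin k)) → Vec Pos k → ℕ → Fin k → ℕ → Subset k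
FH prio σ i s = run prio σ (just (i , s))

StrictlyBetween : {Pos : Set} → (Pos → Pos → Set) → Pos → Pos → Pos → Set
StrictlyBetween _<_ u v w = (u < v × v < w) ⊎ (w < v × v < u)

Surrounding : {Pos : Set} {k : ℕ} → (Pos → Pos → Set) → (Fin k → Pos) →
              Subset k → Pos → Fin k → Set
Surrounding _<_ pos F r s =
  s ∈ F ×
  ( pos s ≡ r
  ⊎ ( (∀ x → x ∈ F → ¬ pos x ≡ r) ×
      ( (pos s < r × (∀ x → x ∈ F → ¬ (pos s < pos x × pos x < r)))
      ⊎ (r < pos s × (∀ x → x ∈ F → ¬ (r < pos x × pos x < pos s))))))

SurroundingOriented : {Pos : Set} {k : ℕ} → (Pos → Pos → Set) → (Fin k → Pos) →
                      (Pos → List (Fin k)) → Set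
SurroundingOriented {Pos} {k} _<_ pos prio =
  (σ : Vec Pos k) (t : ℕ) (r : Pos) (s : Fin k) →
  lookupℕ σ t ≡ just r →
  first (prio r) (FA prio σ t) ≡ just s →
  Surrounding _<_ pos (FA prio σ t) r s

_≤[_]_ : {Pos : Set} → Pos → (Pos → Pos → Set) → Pos → Set
x ≤[ _<_ ] y = x < y ⊎ x ≡ y

-- While the two runs differ, their free sets are C ∪ {a} and C ∪ {h} for a common set C, and both
-- runs use the same priority list. If the highest-priority server y of C ∪ {a, h} lies in C, both
-- serve y and nothing changes. If y = a, then A serves a, which surrounds the request in C ∪ {a, h};
-- the hybrid serves a surrounding server of the request in C ∪ {h} other than h (otherwise the runs
-- merge), and this is the neighbour of a in C on the side away from h: it becomes the new a. The
-- case y = h is the mirror image under reversing the order. Hence a and h stay neighbours among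
-- C ∪ {a, h} and only move apart.

module Submission where

open import Defs
open import Data.Nat using (ℕ; zero; suc; _≤_; _<_; _∸_; _≤′_; ≤′-refl; ≤′-step; s≤s)
open import Data.Nat.Properties using (≤-refl; <-irrefl; <⇒≤; n<1+n; m<n⇒m<1+n; m≤n⇒m≤1+n; ≤⇒≤′; ≤′⇒≤; 1+n≰n)
  renaming (_≟_ to _≟ℕ_)
open import Data.Bool using (true; false)
open import Data.Fin using (Fin) renaming (_≟_ to _≟ᶠ_)
open import Data.Fin.Subset using (Subset; _∈_; _∉_; _⊆_; _∪_; ⊤; outside)
open import Data.Fin.Subset.Properties using (_∈?_; ∈⊤; ⊆-antisym; ∪-comm; p⊆p∪q; q⊆p∪q; x∈p∪q⁻)
open import Data.List using (List; []; _∷_; length; allFin; filter; foldr)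
open import Data.List.Properties using (filter-notAll; length-tabulate)
open import Data.List.Membership.Propositional using () renaming (_∈_ to _∈ₗ_; _∉_ to _∉ₗ_)
open import Data.List.Membership.Propositional.Properties using (∈-allFin; ∈-filter⁺; ∈-filter⁻)
open import Data.List.Relation.Unary.Any as Any using (here; there)
open import Data.List.Relation.Unary.All.Properties using (All¬⇒¬Any)
open import Data.List.Relation.Unary.AllPairs using (_∷_)
open import Data.List.Relation.Unary.Unique.Propositional using (Unique)
open import Data.List.Relation.Unary.Unique.Propositional.Properties using (allFin⁺) renaming (filter⁺ to Unique-filter⁺)
open import Data.List.Relation.Binary.Permutation.Propositional using (_↭_; ↭-sym)
open import Data.List.Relation.Binary.Permutation.Propositional.Properties using (∈-resp-↭)
open import Data.Vec using (Vec; []; _∷_; lookup; _[_]≔_; replicate)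
open import Data.Vec.Properties using ([]=⇒lookup; lookup⇒[]=; []=-injective; []≔-updates; []≔-minimal; lookup∘update′)
open import Data.Maybe using (Maybe; just; nothing)
open import Data.Maybe.Properties using (just-injective)
open import Data.Product using (_×_; Σ; _,_; proj₁; proj₂)
open import Data.Sum using (_⊎_; inj₁; inj₂; [_,_])
open import Function using (flip; _∘_)
open import Relation.Nullary using (¬_; Dec; yes; no; ¬?; contradiction)
open import Relation.Binary.Structures using (IsStrictTotalOrder)
open import Relation.Binary.Definitions using (tri<; tri≈; tri>)
import Relation.Binary.Construct.Flip.EqAndOrd as Flip
open import Relation.Binary.PropositionalEquality
  using (_≡_; _≢_; refl; sym; trans; cong; cong₂; subst; subst₂; module ≡-Reasoning)

private
  variable
    Pos : Set
    k : ℕ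
    F G F′ G′ U : Subset k
    a h a′ h′ u v x y : Fin k

∉-removed : (F : Subset k) (x : Fin k) → x ∉ F [ x ]≔ outside
∉-removed F x x∈ with []=-injective x∈ ([]≔-updates F x)
... | ()

∈-removed⁺ : x ≢ y → x ∈ F → x ∈ F [ y ]≔ outside
∈-removed⁺ {x = x} {y} {F} x≢y = []≔-minimal F x y x≢y

∈-removed⁻ : x ∈ F [ y ]≔ outside → x ∈ F
∈-removed⁻ {x = x} {F} {y} x∈ with x ≟ᶠ y
... | yes refl = contradiction x∈ (∉-removed F x)
... | no x≢y = lookup⇒[]= x F (trans (sym (lookup∘update′ x≢y F outside)) ([]=⇒lookup x∈))

first-∈ : (L : List (Fin k)) (F : Subset k) → first L F ≡ just y → y ∈ F
first-∈ (x ∷ L) F e with lookup F x in F[x]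
first-∈ (x ∷ L) F refl | true = lookup⇒[]= x F F[x]
... | false = first-∈ L F e

first-complete : (L : List (Fin k)) (F : Subset k) → x ∈ₗ L → x ∈ F → Σ (Fin k) λ y → first L F ≡ just y
first-complete (z ∷ L) F x∈L x∈F with lookup F z in F[z]
... | true = z , refl
first-complete (z ∷ L) F (here refl) x∈F | false with () ← trans (sym F[z]) ([]=⇒lookup x∈F)
first-complete (z ∷ L) F (there x∈L) x∈F | false = first-complete L F x∈L x∈F

first-⊆ : (L : List (Fin k)) → F ⊆ U → first L U ≡ just y → y ∈ F → first L F ≡ just y
first-⊆ {F = F} {U} (x ∷ L) F⊆U e y∈F with lookup U x in U[x]
first-⊆ {F = F} (x ∷ L) F⊆U refl y∈F | true rewrite []=⇒lookup y∈F = refl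
... | false with lookup F x in F[x]
... | true with () ← trans (sym U[x]) ([]=⇒lookup (F⊆U (lookup⇒[]= x F F[x])))
... | false = first-⊆ L F⊆U e y∈F

first-served : (L : List (Fin k)) → F ⊆ U → first L F ≡ just u → first L U ≡ just y → y ∈ F → u ≡ y
first-served L F⊆U fu fy y∈F = just-injective (trans (sym fu) (first-⊆ L F⊆U fy y∈F))

setℕ : {A : Set} {n : ℕ} → Vec A n → ℕ → A → Vec A n
setℕ []       _       _ = []
setℕ (x ∷ xs) zero    z = z ∷ xs
setℕ (x ∷ xs) (suc j) z = x ∷ setℕ xs j z

lookupℕ-setℕ : {A : Set} {n : ℕ} (xs : Vec A n) (j : ℕ) (z : A) → j < n → lookupℕ (setℕ xs j z) j ≡ just z
lookupℕ-setℕ (x ∷ xs) zero    z _         = refl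
lookupℕ-setℕ (x ∷ xs) (suc j) z (s≤s j<n) = lookupℕ-setℕ xs j z j<n

lookupℕ-setℕ-≢ : {A : Set} {n : ℕ} (xs : Vec A n) {j j′ : ℕ} (z : A) → j ≢ j′ →
                 lookupℕ (setℕ xs j z) j′ ≡ lookupℕ xs j′
lookupℕ-setℕ-≢ []       z _ = refl
lookupℕ-setℕ-≢ (x ∷ xs) {zero}  {zero}   z j≢j′ = contradiction refl j≢j′
lookupℕ-setℕ-≢ (x ∷ xs) {zero}  {suc j′} z _    = refl
lookupℕ-setℕ-≢ (x ∷ xs) {suc j} {zero}   z _    = refl
lookupℕ-setℕ-≢ (x ∷ xs) {suc j} {suc j′} z j≢j′ = lookupℕ-setℕ-≢ xs z (j≢j′ ∘ cong suc)

allBut : List (Fin k) → Subset k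
allBut = foldr (λ x F → F [ x ]≔ outside) ⊤

∈-allBut⁺ : (L : List (Fin k)) → x ∉ₗ L → x ∈ allBut L
∈-allBut⁺ []      _   = ∈⊤
∈-allBut⁺ (y ∷ L) x∉L = ∈-removed⁺ (x∉L ∘ here) (∈-allBut⁺ L (x∉L ∘ there))

∈-allBut⁻ : (L : List (Fin k)) → x ∈ allBut L → x ∉ₗ L
∈-allBut⁻ (y ∷ L) x∈ (here refl) = ∉-removed (allBut L) y x∈
∈-allBut⁻ (y ∷ L) x∈ (there x∈L) = ∈-allBut⁻ L (∈-removed⁻ x∈) x∈L

SurroundingRule : (Pos → Pos → Set) → (Fin k → Pos) → (Pos → List (Fin k)) → Set
SurroundingRule {Pos} {k} _≺_ pos prio =
  (F : Subset k) (r : Pos) (y : Fin k) → first (prio r) F ≡ just y → Surrounding _≺_ pos F r y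

Surrounding-flip : {_≺_ : Pos → Pos → Set} {pos : Fin k → Pos} {r : Pos} →
                   Surrounding _≺_ pos F r y → Surrounding (flip _≺_) pos F r y
Surrounding-flip (y∈ , inj₁ coincident) = y∈ , inj₁ coincident
Surrounding-flip (y∈ , inj₂ (apart , inj₁ (y<r , gap))) =
  y∈ , inj₂ (apart , inj₂ (y<r , λ x x∈ (p , q) → gap x x∈ (q , p)))
Surrounding-flip (y∈ , inj₂ (apart , inj₂ (r<y , gap))) =
  y∈ , inj₂ (apart , inj₁ (r<y , λ x x∈ (p , q) → gap x x∈ (q , p)))

SurroundingRule-flip : {_≺_ : Pos → Pos → Set} {pos : Fin k → Pos} {prio : Pos → List (Fin k)} →
                       SurroundingRule _≺_ pos prio → SurroundingRule (flip _≺_) pos prio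
SurroundingRule-flip {_≺_ = _≺_} rule F r y fy = Surrounding-flip {_≺_ = _≺_} (rule F r y fy)

surrounding-coincident : {_≺_ : Pos → Pos → Set} {pos : Fin k → Pos} {r : Pos} →
                         (∀ x y → pos x ≡ pos y → x ≡ y) →
                         Surrounding _≺_ pos F r y → x ∈ F → pos x ≡ r → x ≡ y
surrounding-coincident {y = y} {x = x} pos-injective (_ , inj₁ y≡r) _ x≡r = pos-injective x y (trans x≡r (sym y≡r))
surrounding-coincident pos-injective (_ , inj₂ (apart , _)) x∈ x≡r = contradiction x≡r (apart _ x∈)

StrictlyBetween-flip : {_≺_ : Pos → Pos → Set} {u v w : Pos} →
                       StrictlyBetween _≺_ u v w → StrictlyBetween (flip _≺_) u v w
StrictlyBetween-flip (inj₁ (p , q)) = inj₂ (q , p)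
StrictlyBetween-flip (inj₂ (p , q)) = inj₁ (q , p)

≤-flip : {_≺_ : Pos → Pos → Set} {u w : Pos} → u ≤[ flip _≺_ ] w → w ≤[ _≺_ ] u
≤-flip (inj₁ w<u) = inj₁ w<u
≤-flip (inj₂ u≡w) = inj₂ (sym u≡w)

-- Every free set is the free set of A on a suitable request sequence (serve the other servers
-- one by one at their own positions), so A's rule picks surrounding servers from arbitrary free sets.
module Realisation {_≺_ : Pos → Pos → Set}
                   (pos : Fin k → Pos) (pos-injective : ∀ x y → pos x ≡ pos y → x ≡ y)
                   (prio : Pos → List (Fin k)) (prio-complete : ∀ r x → x ∈ₗ prio r)
                   (oriented : SurroundingOriented _≺_ pos prio) where

  FA-prefix : (σ σ′ : Vec Pos k) (t : ℕ) → (∀ j → j < t → lookupℕ σ j ≡ lookupℕ σ′ j) →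
              FA prio σ t ≡ FA prio σ′ t
  FA-prefix σ σ′ zero    _    = refl
  FA-prefix σ σ′ (suc t) same =
    cong₂ (mpfsStep prio) (FA-prefix σ σ′ t (λ j j<t → same j (m<n⇒m<1+n j<t))) (same t ≤-refl)

  FA-serves-coincident : (σ : Vec Pos k) (t : ℕ) → lookupℕ σ t ≡ just (pos x) → x ∈ FA prio σ t →
                         FA prio σ (suc t) ≡ FA prio σ t [ x ]≔ outside
  FA-serves-coincident {x = x} σ t σ[t] x∈
    with y , fy ← first-complete (prio (pos x)) _ (prio-complete _ x) x∈ =
    trans (cong (mpfsStep prio (FA prio σ t)) σ[t]) (cong (removeM _) (trans fy (cong just (sym x≡y))))
    where
    x≡y : x ≡ y
    x≡y = surrounding-coincident {_≺_ = _≺_} pos-injective (oriented σ t (pos x) y σ[t] fy) x∈ refl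

  requests : List (Fin k) → Pos → Vec Pos k
  requests []      r = replicate k r
  requests (x ∷ L) r = setℕ (requests L (pos x)) (suc (length L)) r

  requests-last : (L : List (Fin k)) (r : Pos) → length L < k → lookupℕ (requests L r) (length L) ≡ just r
  requests-last []      r (s≤s _) = refl
  requests-last (x ∷ L) r 1+n<k   = lookupℕ-setℕ (requests L (pos x)) (suc (length L)) r 1+n<k

  requests-free : (L : List (Fin k)) (r : Pos) → Unique L → length L < k →
                  FA prio (requests L r) (length L) ≡ allBut L
  requests-free []      r _            _     = refl
  requests-free (x ∷ L) r (x∉L ∷ uniq) 1+n<k = begin
    FA prio (requests (x ∷ L) r) (suc n)
      ≡⟨ FA-prefix (requests (x ∷ L) r) (requests L (pos x)) (suc n) earlier-unchanged ⟩
    FA prio (requests L (pos x)) (suc n)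
      ≡⟨ FA-serves-coincident (requests L (pos x)) n (requests-last L (pos x) n<k) x-free ⟩
    FA prio (requests L (pos x)) n [ x ]≔ outside
      ≡⟨ cong (_[ x ]≔ outside) free-before ⟩
    allBut L [ x ]≔ outside
      ∎
    where
    open ≡-Reasoning
    n : ℕ
    n = length L
    n<k : n < k
    n<k = <⇒≤ 1+n<k
    free-before : FA prio (requests L (pos x)) n ≡ allBut L
    free-before = requests-free L (pos x) uniq n<k
    x-free : x ∈ FA prio (requests L (pos x)) n
    x-free = subst (x ∈_) (sym free-before) (∈-allBut⁺ L (All¬⇒¬Any x∉L))
    earlier-unchanged : ∀ j → j < suc n → lookupℕ (requests (x ∷ L) r) j ≡ lookupℕ (requests L (pos x)) j
    earlier-unchanged j j<1+n = lookupℕ-setℕ-≢ (requests L (pos x)) r (λ 1+n≡j → <-irrefl (sym 1+n≡j) j<1+n)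

  surrounding-rule : SurroundingRule _≺_ pos prio
  surrounding-rule F r y fy =
    subst (λ W → Surrounding _≺_ pos W r y) reached
          (oriented σ (length L) r y (requests-last L r n<k) (subst (λ W → first (prio r) W ≡ just y) (sym reached) fy))
    where
    ∉F? : ∀ x → Dec (x ∉ F)
    ∉F? x = ¬? (x ∈? F)
    L : List (Fin k)
    L = filter ∉F? (allFin k)
    σ : Vec Pos k
    σ = requests L r
    n<k : length L < k
    n<k = subst (length L <_) (length-tabulate (λ x → x))
                (filter-notAll ∉F? (allFin k) (Any.map (λ { refl y∉F → y∉F (first-∈ (prio r) F fy) }) (∈-allFin y)))
    allBut-L⊆F : allBut L ⊆ F
    allBut-L⊆F {x} x∈ with x ∈? F
    ... | yes x∈F = x∈F
    ... | no x∉F = contradiction (∈-filter⁺ ∉F? (∈-allFin x) x∉F) (∈-allBut⁻ L x∈)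
    F⊆allBut-L : F ⊆ allBut L
    F⊆allBut-L x∈F = ∈-allBut⁺ L (λ x∈L → proj₂ (∈-filter⁻ ∉F? {xs = allFin k} x∈L) x∈F)
    reached : FA prio σ (length L) ≡ F
    reached = trans (requests-free L r (Unique-filter⁺ ∉F? {xs = allFin k} (allFin⁺ k)) n<k)
                    (⊆-antisym allBut-L⊆F F⊆allBut-L)

module HybridRun (prio : Pos → List (Fin k)) (σ : Vec Pos k) (i′ : ℕ) (s : Fin k) where

  hybrid-follows-rule : ∀ t → suc t ≢ suc i′ →
                        FH prio σ (suc i′) s (suc t) ≡ mpfsStep prio (FH prio σ (suc i′) s t) (lookupℕ σ t)
  hybrid-follows-rule t t≢i with suc t ≟ℕ suc i′
  ... | yes t≡i = contradiction t≡i t≢i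
  ... | no _ = refl

  hybrid-agrees-before : ∀ t → t < suc i′ → FH prio σ (suc i′) s t ≡ FA prio σ t
  hybrid-agrees-before zero _ = refl
  hybrid-agrees-before (suc t) t<i =
    trans (hybrid-follows-rule t (λ t≡i → <-irrefl t≡i t<i))
          (cong (λ W → mpfsStep prio W (lookupℕ σ t)) (hybrid-agrees-before t (<⇒≤ t<i)))

  hybrid-deviates : FH prio σ (suc i′) s (suc i′) ≡ FA prio σ i′ [ s ]≔ outside
  hybrid-deviates with suc i′ ≟ℕ suc i′
  ... | yes _ = cong (_[ s ]≔ outside) (hybrid-agrees-before i′ (n<1+n i′))
  ... | no i≢i = contradiction refl i≢i

infix 4 _∖_≐⁅_⁆
_∖_≐⁅_⁆ : Subset k → Subset k → Fin k → Set
F ∖ G ≐⁅ a ⁆ = ∀ x → ((x ∈ F × x ∉ G) → x ≡ a) × (x ≡ a → (x ∈ F × x ∉ G))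

∖≐-∈ : F ∖ G ≐⁅ a ⁆ → a ∈ F
∖≐-∈ {a = a} d = proj₁ (proj₂ (d a) refl)

∖≐-∉ : F ∖ G ≐⁅ a ⁆ → a ∉ G
∖≐-∉ {a = a} d = proj₂ (proj₂ (d a) refl)

∖≐-unique : F ∖ G ≐⁅ a ⁆ → x ∈ F → x ∉ G → x ≡ a
∖≐-unique {x = x} d x∈F x∉G = proj₁ (d x) (x∈F , x∉G)

∖≐-shared : F ∖ G ≐⁅ a ⁆ → x ∈ F → x ≢ a → x ∈ G
∖≐-shared {G = G} {x = x} d x∈F x≢a with x ∈? G
... | yes x∈G = x∈G
... | no x∉G = contradiction (∖≐-unique d x∈F x∉G) x≢a

∖≐-removals : F′ ≡ F [ y ]≔ outside → G′ ≡ F [ x ]≔ outside → x ∈ F → x ≢ y → F′ ∖ G′ ≐⁅ a ⁆ → a ≡ x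
∖≐-removals {F = F} {x = x} refl refl x∈F x≢y d = sym (∖≐-unique d (∈-removed⁺ x≢y x∈F) (∉-removed F x))

removing-private-servers-equalises : F ∖ G ≐⁅ a ⁆ → G ∖ F ≐⁅ h ⁆ → x ∈ F [ a ]≔ outside → x ∈ G [ h ]≔ outside
removing-private-servers-equalises {F = F} {a = a} {h = h} {x = x} dF dG x∈ = ∈-removed⁺ x≢h (∖≐-shared dF x∈F x≢a)
  where
  x∈F : x ∈ F
  x∈F = ∈-removed⁻ x∈
  x≢a : x ≢ a
  x≢a refl = ∉-removed F a x∈
  x≢h : x ≢ h
  x≢h refl = ∖≐-∉ dG x∈F

Adjacent : (Pos → Pos → Set) → (Fin k → Pos) → Subset k → Subset k → Fin k → Fin k → Set
Adjacent _≺_ pos F G a h = pos a ≺ pos h × (∀ x → x ∈ F → x ∈ G → ¬ (pos a ≺ pos x × pos x ≺ pos h))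

Adjacent-flip : {_≺_ : Pos → Pos → Set} {pos : Fin k → Pos} →
                Adjacent _≺_ pos F G a h → Adjacent (flip _≺_) pos G F h a
Adjacent-flip (a<h , gap) = a<h , λ x x∈G x∈F (x<h , a<x) → gap x x∈F x∈G (a<x , x<h)

Adjacent-after-deviation : {_≺_ : Pos → Pos → Set} {pos : Fin k → Pos} →
  pos x ≺ pos y → (∀ z → z ∈ F → ¬ StrictlyBetween _≺_ (pos y) (pos z) (pos x)) →
  F′ ≡ F [ y ]≔ outside → G′ ≡ F [ x ]≔ outside → a′ ≡ x → h′ ≡ y → Adjacent _≺_ pos F′ G′ a′ h′
Adjacent-after-deviation x<y no-between refl refl refl refl =
  x<y , λ z z∈F′ _ between → no-between z (∈-removed⁻ z∈F′) (inj₂ between)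

Adjacent-preserved : {_≺_ : Pos → Pos → Set} {pos : Fin k → Pos} →
  F ∖ G ≐⁅ a ⁆ → G ∖ F ≐⁅ h ⁆ → Adjacent _≺_ pos F G a h →
  F′ ⊆ F → G′ ⊆ G → a ∈ F′ → h ∈ G′ → F′ ∖ G′ ≐⁅ a′ ⁆ → G′ ∖ F′ ≐⁅ h′ ⁆ →
  Adjacent _≺_ pos F′ G′ a′ h′ × pos a′ ≤[ _≺_ ] pos a × pos h ≤[ _≺_ ] pos h′
Adjacent-preserved dF dG (a<h , gap) F′⊆F G′⊆G a∈F′ h∈G′ dF′ dG′
  rewrite ∖≐-unique dF′ a∈F′ (∖≐-∉ dF ∘ G′⊆G) | ∖≐-unique dG′ h∈G′ (∖≐-∉ dG ∘ F′⊆F) =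
  (a<h , λ x x∈F′ x∈G′ → gap x (F′⊆F x∈F′) (G′⊆G x∈G′)) , inj₂ refl , inj₂ refl

module Geometry {_≺_ : Pos → Pos → Set} (sto : IsStrictTotalOrder _≡_ _≺_)
                (pos : Fin k → Pos) (pos-injective : ∀ x y → pos x ≡ pos y → x ≡ y) where

  open IsStrictTotalOrder sto using (compare; asym; irrefl) renaming (trans to ≺-trans)

  ≺-irrefl : ∀ {p} → ¬ p ≺ p
  ≺-irrefl = irrefl refl

  Gap : Subset k → Fin k → Fin k → Set
  Gap F u w = ∀ x → x ∈ F → ¬ (pos u ≺ pos x × pos x ≺ pos w)

  surrounding-gap : ∀ {r} → Surrounding _≺_ pos F r y → x ∈ F → ¬ StrictlyBetween _≺_ r (pos x) (pos y)
  surrounding-gap (_ , inj₁ y≡r) _ (inj₁ (r<x , x<y)) = ≺-irrefl (≺-trans r<x (subst (_ ≺_) y≡r x<y))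
  surrounding-gap (_ , inj₁ y≡r) _ (inj₂ (y<x , x<r)) = ≺-irrefl (≺-trans (subst (_≺ _) y≡r y<x) x<r)
  surrounding-gap (_ , inj₂ (_ , inj₁ (y<r , _))) _ (inj₁ (r<x , x<y)) = asym y<r (≺-trans r<x x<y)
  surrounding-gap (_ , inj₂ (_ , inj₁ (_ , gap))) x∈ (inj₂ between) = gap _ x∈ between
  surrounding-gap (_ , inj₂ (_ , inj₂ (_ , gap))) x∈ (inj₁ between) = gap _ x∈ between
  surrounding-gap (_ , inj₂ (_ , inj₂ (r<y , _))) _ (inj₂ (y<x , x<r)) = asym r<y (≺-trans y<x x<r)

  -- If q is the right neighbour in F of a server p ∉ F, and p surrounds r in U ⊇ F, then r lies
  -- between the left neighbour of p and q; so a surrounding server of r in F other than q is that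
  -- left neighbour.
  surrounding-passes-left : ∀ {p q c r} → F ⊆ U → p ∉ F → q ∈ F → pos p ≺ pos q → Gap F p q →
    Surrounding _≺_ pos U r p → Surrounding _≺_ pos F r c → c ≢ q → pos c ≺ pos p × Gap F c q
  surrounding-passes-left {F = F} {p = p} {q} {c} {r} F⊆U p∉F q∈F p<q gap surU surF@(c∈F , _) c≢q =
    below-p c∈F c<q , gap′
    where
    r<q : r ≺ pos q
    r<q with compare r (pos q)
    ... | tri< r<q _ _ = r<q
    ... | tri≈ _ r≡q _ =
      contradiction (subst (_∈ F) (surrounding-coincident {_≺_ = _≺_} pos-injective surU (F⊆U q∈F) (sym r≡q)) q∈F) p∉F
    ... | tri> _ _ q<r = contradiction (inj₂ (p<q , q<r)) (surrounding-gap surU (F⊆U q∈F))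
    c<q : pos c ≺ pos q
    c<q with compare (pos c) (pos q)
    ... | tri< c<q _ _ = c<q
    ... | tri≈ _ c≡q _ = contradiction (pos-injective c q c≡q) c≢q
    ... | tri> _ _ q<c = contradiction (inj₁ (r<q , q<c)) (surrounding-gap surF q∈F)
    below-p : ∀ {x} → x ∈ F → pos x ≺ pos q → pos x ≺ pos p
    below-p {x} x∈F x<q with compare (pos x) (pos p)
    ... | tri< x<p _ _ = x<p
    ... | tri≈ _ x≡p _ = contradiction (subst (_∈ F) (pos-injective x p x≡p) x∈F) p∉F
    ... | tri> _ _ p<x = contradiction (p<x , x<q) (gap x x∈F)
    gap′ : Gap F c q
    gap′ x x∈F (c<x , x<q) with compare (pos x) r
    ... | tri< x<r _ _ = surrounding-gap surF x∈F (inj₂ (c<x , x<r))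
    ... | tri≈ _ x≡r _ =
      ≺-irrefl (subst (λ z → pos c ≺ pos z) (surrounding-coincident {_≺_ = _≺_} pos-injective surF x∈F x≡r) c<x)
    ... | tri> _ _ r<x = surrounding-gap surU (F⊆U x∈F) (inj₁ (r<x , below-p x∈F x<q))

  Adjacent⇒no-common-between : Adjacent _≺_ pos F G a h → x ∈ F → x ∈ G →
                               ¬ StrictlyBetween _≺_ (pos a) (pos x) (pos h)
  Adjacent⇒no-common-between (_ , gap) x∈F x∈G (inj₁ between) = gap _ x∈F x∈G between
  Adjacent⇒no-common-between (a<h , _) _ _ (inj₂ (h<x , x<a)) = asym a<h (≺-trans h<x x<a)

  Adjacent⇒Gap : G ∖ F ≐⁅ h ⁆ → Adjacent _≺_ pos F G a h → Gap G a h
  Adjacent⇒Gap {F = F} {h = h} dG (_ , gap) x x∈G (a<x , x<h) with x ∈? F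
  ... | yes x∈F = gap x x∈F x∈G (a<x , x<h)
  ... | no x∉F = ≺-irrefl (subst (λ z → pos z ≺ pos h) (∖≐-unique dG x∈G x∉F) x<h)

module PrivateServer {_≺_ : Pos → Pos → Set} (sto : IsStrictTotalOrder _≡_ _≺_)
                    (pos : Fin k → Pos) (pos-injective : ∀ x y → pos x ≡ pos y → x ≡ y)
                    (prio : Pos → List (Fin k)) (rule : SurroundingRule _≺_ pos prio) where

  open Geometry sto pos pos-injective
  open IsStrictTotalOrder sto using () renaming (trans to ≺-trans)

  serving-private-server : ∀ {r} → F ∖ G ≐⁅ a ⁆ → G ∖ F ≐⁅ h ⁆ → Adjacent _≺_ pos F G a h →
    first (prio r) (F ∪ G) ≡ just a → first (prio r) G ≡ just v →
    (F [ a ]≔ outside) ∖ (G [ v ]≔ outside) ≐⁅ a′ ⁆ → (G [ v ]≔ outside) ∖ (F [ a ]≔ outside) ≐⁅ h′ ⁆ →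
    Adjacent _≺_ pos (F [ a ]≔ outside) (G [ v ]≔ outside) a′ h′ × pos a′ ≺ pos a × h′ ≡ h
  serving-private-server {F = F} {G} {a} {h} {v} {a′} {h′} {r} dF dG adj fa fv dF′ dG′
    = subst₂ (λ a″ h″ → Adjacent _≺_ pos _ _ a″ h″ × pos a″ ≺ pos a × h″ ≡ h) (sym a′≡v) (sym h′≡h)
             ((≺-trans v<a (proj₁ adj) , λ x _ x∈G′ → gap x (∈-removed⁻ x∈G′)) , v<a , refl)
    where
    v∈G : v ∈ G
    v∈G = first-∈ (prio r) G fv
    v≢h : v ≢ h
    v≢h refl = ∖≐-∉ dF′ (removing-private-servers-equalises dF dG (∖≐-∈ dF′))
    v≢a : v ≢ a
    v≢a refl = ∖≐-∉ dF v∈G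
    a′≡v : a′ ≡ v
    a′≡v = sym (∖≐-unique dF′ (∈-removed⁺ v≢a (∖≐-shared dG v∈G v≢h)) (∉-removed G v))
    h′≡h : h′ ≡ h
    h′≡h = sym (∖≐-unique dG′ (∈-removed⁺ (v≢h ∘ sym) (∖≐-∈ dG)) (∖≐-∉ dG ∘ ∈-removed⁻))
    moved : pos v ≺ pos a × Gap G v h
    moved = surrounding-passes-left (q⊆p∪q F G) (∖≐-∉ dF) (∖≐-∈ dG) (proj₁ adj) (Adjacent⇒Gap dG adj)
                                    (rule _ _ _ fa) (rule _ _ _ fv) v≢h
    v<a : pos v ≺ pos a
    v<a = proj₁ moved
    gap : Gap G v h
    gap = proj₂ moved

module Step {_≺_ : Pos → Pos → Set} (sto : IsStrictTotalOrder _≡_ _≺_)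
            (pos : Fin k → Pos) (pos-injective : ∀ x y → pos x ≡ pos y → x ≡ y)
            (prio : Pos → List (Fin k)) (prio-complete : ∀ r x → x ∈ₗ prio r)
            (rule : SurroundingRule _≺_ pos prio) where

  private
    module Forward = PrivateServer sto pos pos-injective prio rule
    module Mirrored = PrivateServer (Flip.isStrictTotalOrder sto) pos pos-injective prio
                                   (SurroundingRule-flip {_≺_ = _≺_} {prio = prio} rule)

  Adjacent-after-serving : ∀ {r} → F ∖ G ≐⁅ a ⁆ → G ∖ F ≐⁅ h ⁆ → Adjacent _≺_ pos F G a h →
    first (prio r) F ≡ just u → first (prio r) G ≡ just v →
    F′ ≡ F [ u ]≔ outside → G′ ≡ G [ v ]≔ outside → F′ ∖ G′ ≐⁅ a′ ⁆ → G′ ∖ F′ ≐⁅ h′ ⁆ →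
    Adjacent _≺_ pos F′ G′ a′ h′ × pos a′ ≤[ _≺_ ] pos a × pos h ≤[ _≺_ ] pos h′
  Adjacent-after-serving {F = F} {G} {r = r} dF dG adj fu fv refl refl dF′ dG′
    with y , fy ← first-complete (prio r) (F ∪ G) (prio-complete r _) (p⊆p∪q G (∖≐-∈ dF))
    with y ∈? F | y ∈? G
  ... | yes y∈F | yes y∈G
    with refl ← first-served (prio r) (p⊆p∪q G) fu fy y∈F
       | refl ← first-served (prio r) (q⊆p∪q F G) fv fy y∈G
    = Adjacent-preserved {_≺_ = _≺_} {pos = pos} dF dG adj ∈-removed⁻ ∈-removed⁻
        (∈-removed⁺ (λ { refl → ∖≐-∉ dF y∈G }) (∖≐-∈ dF)) (∈-removed⁺ (λ { refl → ∖≐-∉ dG y∈F }) (∖≐-∈ dG)) dF′ dG′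
  ... | yes y∈F | no y∉G
    with refl ← ∖≐-unique dF y∈F y∉G
       | refl ← first-served (prio r) (p⊆p∪q G) fu fy y∈F
    with adj′ , a′<a , h′≡h ← Forward.serving-private-server dF dG adj fy fv dF′ dG′
    = adj′ , inj₁ a′<a , inj₂ (cong pos (sym h′≡h))
  ... | no y∉F | yes y∈G
    with refl ← ∖≐-unique dG y∈G y∉F
       | refl ← first-served (prio r) (q⊆p∪q F G) fv fy y∈G
    with adj′ , h′>h , a′≡a ← Mirrored.serving-private-server dG dF (Adjacent-flip {_≺_ = _≺_} adj)
                                (subst (λ W → first (prio r) W ≡ just _) (∪-comm F G) fy) fu dG′ dF′
    = Adjacent-flip {_≺_ = flip _≺_} adj′ , inj₂ (cong pos a′≡a) , inj₁ h′>h
  ... | no y∉F | no y∉G = contradiction (first-∈ (prio r) (F ∪ G) fy) ([ y∉F , y∉G ] ∘ x∈p∪q⁻ F G)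

  Adjacent-step : F ∖ G ≐⁅ a ⁆ → G ∖ F ≐⁅ h ⁆ → Adjacent _≺_ pos F G a h → (m : Maybe Pos) →
    F′ ≡ mpfsStep prio F m → G′ ≡ mpfsStep prio G m → F′ ∖ G′ ≐⁅ a′ ⁆ → G′ ∖ F′ ≐⁅ h′ ⁆ →
    Adjacent _≺_ pos F′ G′ a′ h′ × pos a′ ≤[ _≺_ ] pos a × pos h ≤[ _≺_ ] pos h′
  Adjacent-step dF dG adj nothing refl refl =
    Adjacent-preserved {_≺_ = _≺_} {pos = pos} dF dG adj (λ x∈ → x∈) (λ x∈ → x∈) (∖≐-∈ dF) (∖≐-∈ dG)
  Adjacent-step {F = F} {G} dF dG adj (just r) F′≡ G′≡
    with u , fu ← first-complete (prio r) F (prio-complete r _) (∖≐-∈ dF)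
       | v , fv ← first-complete (prio r) G (prio-complete r _) (∖≐-∈ dG)
    = Adjacent-after-serving dF dG adj fu fv (trans F′≡ (cong (removeM F) fu)) (trans G′≡ (cong (removeM G) fv))

module Outward {_≺_ : Pos → Pos → Set} (sto : IsStrictTotalOrder _≡_ _≺_)
               (pos : Fin k → Pos) (pos-injective : ∀ x y → pos x ≡ pos y → x ≡ y)
               (prio : Pos → List (Fin k)) (prio-complete : ∀ r x → x ∈ₗ prio r)
               (rule : SurroundingRule _≺_ pos prio)
               (σ : Vec Pos k) (i′ : ℕ) (s : Fin k) (tstar : ℕ) (a h : ℕ → Fin k)
               (a-private : ∀ t → suc i′ ≤ t → t ≤ tstar → FA prio σ t ∖ FH prio σ (suc i′) s t ≐⁅ a t ⁆)
               (h-private : ∀ t → suc i′ ≤ t → t ≤ tstar → FH prio σ (suc i′) s t ∖ FA prio σ t ≐⁅ h t ⁆) where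

  open Step sto pos pos-injective prio prio-complete rule
  open Geometry sto pos pos-injective using (Adjacent⇒no-common-between)
  open HybridRun prio σ i′ s

  Invariant : ℕ → Set
  Invariant t = Adjacent _≺_ pos (FA prio σ t) (FH prio σ (suc i′) s t) (a t) (h t)

  invariant-step : ∀ {t} → suc i′ ≤ t → t < tstar → Invariant t →
            Invariant (suc t) × pos (a (suc t)) ≤[ _≺_ ] pos (a t) × pos (h t) ≤[ _≺_ ] pos (h (suc t))
  invariant-step {t} i≤t t<tstar inv =
    Adjacent-step (a-private t i≤t (<⇒≤ t<tstar)) (h-private t i≤t (<⇒≤ t<tstar)) inv (lookupℕ σ t)
         refl (hybrid-follows-rule t (λ t≡i → 1+n≰n (subst (_≤ t) (sym t≡i) i≤t)))
         (a-private (suc t) (m≤n⇒m≤1+n i≤t) t<tstar) (h-private (suc t) (m≤n⇒m≤1+n i≤t) t<tstar)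

  invariant-from : Invariant (suc i′) → ∀ {t} → suc i′ ≤′ t → t ≤ tstar → Invariant t
  invariant-from base ≤′-refl              _       = base
  invariant-from base (≤′-step i≤′t) t<tstar =
    proj₁ (invariant-step (≤′⇒≤ i≤′t) t<tstar (invariant-from base i≤′t (<⇒≤ t<tstar)))

  invariant-holds : Invariant (suc i′) → ∀ t → suc i′ ≤ t → t ≤ tstar → Invariant t
  invariant-holds base t i≤t = invariant-from base (≤⇒≤′ i≤t)

  moves-outward : Invariant (suc i′) → ∀ t → suc i′ ≤ t → t < tstar →
          pos (a (suc t)) ≤[ _≺_ ] pos (a t) × pos (h t) ≤[ _≺_ ] pos (h (suc t))
  moves-outward base t i≤t t<tstar = proj₂ (invariant-step i≤t t<tstar (invariant-holds base t i≤t (<⇒≤ t<tstar)))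

module Discrepancy {_≺_ : Pos → Pos → Set} (sto : IsStrictTotalOrder _≡_ _≺_)
                   (pos : Fin k → Pos) (pos-injective : ∀ x y → pos x ≡ pos y → x ≡ y)
                   (prio : Pos → List (Fin k)) (prio-complete : ∀ r x → x ∈ₗ prio r)
                   (rule : SurroundingRule _≺_ pos prio)
                   (σ : Vec Pos k) (i′ : ℕ) (s : Fin k) (tstar : ℕ) (a h : ℕ → Fin k)
                   (a-private : ∀ t → suc i′ ≤ t → t ≤ tstar → FA prio σ t ∖ FH prio σ (suc i′) s t ≐⁅ a t ⁆)
                   (h-private : ∀ t → suc i′ ≤ t → t ≤ tstar → FH prio σ (suc i′) s t ∖ FA prio σ t ≐⁅ h t ⁆) where

  module Forward = Outward sto pos pos-injective prio prio-complete rule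
                           σ i′ s tstar a h a-private h-private
  module Backward = Outward (Flip.isStrictTotalOrder sto) pos pos-injective prio prio-complete
                            (SurroundingRule-flip {_≺_ = _≺_} {prio = prio} rule)
                            σ i′ s tstar a h a-private h-private
  private
    module G  = Geometry sto pos pos-injective
    module Gᶠ = Geometry (Flip.isStrictTotalOrder sto) pos pos-injective

  discrepancy-moves-outward : Forward.Invariant (suc i′) ⊎ Backward.Invariant (suc i′) →
    (∀ t → suc i′ ≤ t → t ≤ tstar → ∀ x → x ∈ FA prio σ t → x ∈ FH prio σ (suc i′) s t →
       ¬ StrictlyBetween _≺_ (pos (a t)) (pos x) (pos (h t)))
    × ( ( (∀ t → suc i′ ≤ t → t < tstar → pos (a (suc t)) ≤[ _≺_ ] pos (a t))
        × pos (a (suc i′)) ≺ pos (h (suc i′))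
        × (∀ t → suc i′ ≤ t → t < tstar → pos (h t) ≤[ _≺_ ] pos (h (suc t))) )
      ⊎ ( (∀ t → suc i′ ≤ t → t < tstar → pos (h (suc t)) ≤[ _≺_ ] pos (h t))
        × pos (h (suc i′)) ≺ pos (a (suc i′))
        × (∀ t → suc i′ ≤ t → t < tstar → pos (a t) ≤[ _≺_ ] pos (a (suc t))) ) )
  discrepancy-moves-outward (inj₁ base) =
    (λ t i≤t t≤tstar x → G.Adjacent⇒no-common-between (Forward.invariant-holds base t i≤t t≤tstar)) ,
    inj₁ ( (λ t i≤t t<tstar → proj₁ (Forward.moves-outward base t i≤t t<tstar))
         , proj₁ base
         , (λ t i≤t t<tstar → proj₂ (Forward.moves-outward base t i≤t t<tstar)) )
  discrepancy-moves-outward (inj₂ base) =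
    (λ t i≤t t≤tstar x x∈A x∈H →
       Gᶠ.Adjacent⇒no-common-between (Backward.invariant-holds base t i≤t t≤tstar) x∈A x∈H
       ∘ StrictlyBetween-flip {_≺_ = _≺_}) ,
    inj₂ ( (λ t i≤t t<tstar → ≤-flip {_≺_ = _≺_} (proj₂ (Backward.moves-outward base t i≤t t<tstar)))
         , proj₁ base
         , (λ t i≤t t<tstar → ≤-flip {_≺_ = _≺_} (proj₁ (Backward.moves-outward base t i≤t t<tstar))) )

lemma4 : {Pos : Set} (_≺_ : Pos → Pos → Set) → IsStrictTotalOrder _≡_ _≺_ →
         (k : ℕ) (pos : Fin k → Pos) → (∀ x y → pos x ≡ pos y → x ≡ y) →
         (prio : Pos → List (Fin k)) → (∀ r → prio r ↭ allFin k) →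
         SurroundingOriented _≺_ pos prio →
         (σ : Vec Pos k) (i : ℕ) → 1 ≤ i → i ≤ k →
         (s : Fin k) → s ∈ FA prio σ (i ∸ 1) →
         (r : Pos) → lookupℕ σ (i ∸ 1) ≡ just r →
         (sA : Fin k) → first (prio r) (FA prio σ (i ∸ 1)) ≡ just sA →
         s ≢ sA →
         (∀ x → x ∈ FA prio σ (i ∸ 1) → ¬ StrictlyBetween _≺_ (pos sA) (pos x) (pos s)) →
         (tstar : ℕ) → i ≤ tstar →
         (∀ t → i ≤ t → t ≤ tstar → FA prio σ t ≢ FH prio σ i s t) →
         (∀ t → tstar < t → FA prio σ t ≡ FH prio σ i s t) →
         (a h : ℕ → Fin k) →
         (∀ t → i ≤ t → t ≤ tstar → ∀ x →
            ((x ∈ FA prio σ t × x ∉ FH prio σ i s t) → x ≡ a t) ×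
            (x ≡ a t → (x ∈ FA prio σ t × x ∉ FH prio σ i s t))) →
         (∀ t → i ≤ t → t ≤ tstar → ∀ x →
            ((x ∈ FH prio σ i s t × x ∉ FA prio σ t) → x ≡ h t) ×
            (x ≡ h t → (x ∈ FH prio σ i s t × x ∉ FA prio σ t))) →
         (∀ t → i ≤ t → t ≤ tstar → ∀ x → x ∈ FA prio σ t → x ∈ FH prio σ i s t →
            ¬ StrictlyBetween _≺_ (pos (a t)) (pos x) (pos (h t)))
         ×
         ( ( (∀ t → i ≤ t → t < tstar → pos (a (suc t)) ≤[ _≺_ ] pos (a t))
           × pos (a i) ≺ pos (h i)
           × (∀ t → i ≤ t → t < tstar → pos (h t) ≤[ _≺_ ] pos (h (suc t))) )
         ⊎ ( (∀ t → i ≤ t → t < tstar → pos (h (suc t)) ≤[ _≺_ ] pos (h t))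
           × pos (h i) ≺ pos (a i)
           × (∀ t → i ≤ t → t < tstar → pos (a t) ≤[ _≺_ ] pos (a (suc t))) ) )
lemma4 {Pos} _≺_ sto k pos pos-injective prio prio↭ oriented σ (suc i′) _ _ s s-free r σ[i′] sA first-sA s≢sA
       no-between tstar i≤tstar _ _ a h a-private h-private = discrepancy-moves-outward deviation-oriented
  where
  prio-complete : ∀ r x → x ∈ₗ prio r
  prio-complete r x = ∈-resp-↭ (↭-sym (prio↭ r)) (∈-allFin x)
  open Discrepancy sto pos pos-injective prio prio-complete
         (Realisation.surrounding-rule {_≺_ = _≺_} pos pos-injective prio prio-complete oriented)
         σ i′ s tstar a h a-private h-private
  open HybridRun prio σ i′ s using (hybrid-deviates)
  A-deviates : FA prio σ (suc i′) ≡ FA prio σ i′ [ sA ]≔ outside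
  A-deviates = trans (cong (mpfsStep prio (FA prio σ i′)) σ[i′]) (cong (removeM _) first-sA)
  a-deviates : a (suc i′) ≡ s
  a-deviates = ∖≐-removals A-deviates hybrid-deviates s-free s≢sA (a-private (suc i′) ≤-refl i≤tstar)
  h-deviates : h (suc i′) ≡ sA
  h-deviates = ∖≐-removals hybrid-deviates A-deviates (first-∈ (prio r) _ first-sA) (s≢sA ∘ sym)
                           (h-private (suc i′) ≤-refl i≤tstar)
  adjacent-at-deviation : {_⊏_ : Pos → Pos → Set} → pos s ⊏ pos sA →
    (∀ z → z ∈ FA prio σ i′ → ¬ StrictlyBetween _⊏_ (pos sA) (pos z) (pos s)) →
    Adjacent _⊏_ pos (FA prio σ (suc i′)) (FH prio σ (suc i′) s (suc i′)) (a (suc i′)) (h (suc i′))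
  adjacent-at-deviation {_⊏_} s⊏sA no-between′ =
    Adjacent-after-deviation {_≺_ = _⊏_} {pos = pos} s⊏sA no-between′
                             A-deviates hybrid-deviates a-deviates h-deviates
  deviation-oriented : Forward.Invariant (suc i′) ⊎ Backward.Invariant (suc i′)
  deviation-oriented with IsStrictTotalOrder.compare sto (pos s) (pos sA)
  ... | tri< s<sA _ _ = inj₁ (adjacent-at-deviation {_⊏_ = _≺_} s<sA no-between)
  ... | tri≈ _ s≡sA _ = contradiction (pos-injective s sA s≡sA) s≢sA
  ... | tri> _ _ sA<s =
    inj₂ (adjacent-at-deviation {_⊏_ = flip _≺_} sA<s
           (λ z z∈ → no-between z z∈ ∘ StrictlyBetween-flip {_≺_ = flip _≺_}))
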